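{- Let $N\ge0$, let $\mathcal S\subseteq\Omega_N\cup\{V\}$ with $U_N\in\mathcal S$, and $\mathcal V=\mathcal S\cup\{V\}$. For $n\ge1$, the expected number of vertical steps in a path chosen uniformly at random from $\mathcal P_{\mathcal V}(1,n)$ equals $$n\cdot\frac{|\mathcal F_{\mathcal V}(0,n)|}{|\mathcal F_{\mathcal V}(1,n)|-|\mathcal F_{\mathcal V}(0,n)|}.$$
   Context: Steps: $V=(0,-1)$ (vertical) and $S_k=(1,k)$ for $k\in\mathbb Z$; $U_k=S_k$ for $k\ge0$. $\Omega_N=\{S_k:k\le N\}$. For a set of steps $\mathcal S$, an $\mathcal S$-path is a finite sequence of steps from $\mathcal S$ starting at $(0,0)$. $\mathcal F_{\mathcal S}(m,n)$ is the set of $\mathcal S$-paths ending at $(n,-m)$; $\mathcal P_{\mathcal S}(m,n)$ is the subset of those all of whose points except possibly the last lie on or above the $x$-axis. -}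

module Defs where

open import Data.Bool using (Bool; T)
open import Data.Nat as ℕ using (ℕ; suc)
open import Data.Integer as ℤ using (ℤ; +_; -_)
open import Data.List using (List; []; _∷_)
open import Data.List.Relation.Unary.All using (All)
open import Data.Product using (Σ; _×_)
open import Data.Unit using (⊤)
open import Data.Fin using (Fin)
open import Data.Vec using (sum; tabulate)
open import Relation.Binary.PropositionalEquality using (_≡_)

-- A step: V = (0,-1), or S k = (1,k) for k ∈ ℤ.
data Step : Set where
  V : Step
  S : ℤ → Step

-- A set of non-vertical steps is given by a decidable predicate on k (S_k ∈ 𝒮 iff s k ≡ true).
-- 𝒱 = 𝒮 ∪ {V}: membership of a step in 𝒱.
InV : (ℤ → Bool) → Step → Set
InV s V     = ⊤
InV s (S k) = T (s k)

endX : List Step → ℕ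
endX []          = 0
endX (V ∷ ps)    = endX ps
endX (S k ∷ ps)  = suc (endX ps)

dy : Step → ℤ
dy V     = - (+ 1)
dy (S k) = k

endY : List Step → ℤ
endY []       = + 0
endY (p ∷ ps) = dy p ℤ.+ endY ps

countV : List Step → ℕ
countV []         = 0
countV (V ∷ ps)   = suc (countV ps)
countV (S k ∷ ps) = countV ps

-- AboveExceptLast y ps : starting at height y, every point of the path
-- except possibly the last one has height ≥ 0.
AboveExceptLast : ℤ → List Step → Set
AboveExceptLast y []       = ⊤
AboveExceptLast y (p ∷ ps) = (+ 0 ℤ.≤ y) × AboveExceptLast (y ℤ.+ dy p) ps

F : (ℤ → Bool) → ℕ → ℕ → Set
F s m n = Σ (List Step) λ ps → All (InV s) ps × endX ps ≡ n × endY ps ≡ - (+ m)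

P : (ℤ → Bool) → ℕ → ℕ → Set
P s m n = Σ (List Step) λ ps → (All (InV s) ps × endX ps ≡ n × endY ps ≡ - (+ m)) × AboveExceptLast (+ 0) ps

sumFin : (c : ℕ) → (Fin c → ℕ) → ℕ
sumFin c f = sum (tabulate f)

-- Cut a path after each non-vertical step into blocks S k V^a.  A path of
-- ℱ(1,n) either starts with V, and removing it leaves a path of ℱ(0,n), or is
-- a word of n blocks with total rise -1.  By the cycle lemma exactly one of the
-- n rotations of such a word is a ballot word, i.e. lies in 𝒫(1,n); hence
-- |ℱ(1,n)| = |ℱ(0,n)| + n |𝒫(1,n)|.  A path V^a w of ℱ(0,n) is the word w with
-- a + 1 vertical steps appended, together with the choice of a below its last
-- run; as the last runs of the n rotations of a ballot word are its n runs,
-- |ℱ(0,n)| is the total number of vertical steps over 𝒫(1,n).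

module Submission where

open import Defs
open import Data.Bool using (Bool; T)
open import Data.Bool.Properties using (T-irrelevant)
open import Data.Nat as ℕ using (ℕ; zero; suc; _+_; _*_; _∸_; _<_; _≤_; _≥_; z≤n; s≤s)
import Data.Nat.Properties as ℕP
open import Data.Integer as ℤ using (ℤ; +_; -_; 0ℤ; 1ℤ; -1ℤ)
import Data.Integer.Properties as ℤP
open import Data.Integer.Tactic.RingSolver using (solve-∀)
open import Data.Fin as Fin using (Fin; toℕ; fromℕ<)
open import Data.Fin.Properties
  using (nonZeroIndex; toℕ-fromℕ<; toℕ-injective; toℕ<n; cantor-schröder-bernstein; +↔⊎; *↔×)
open import Data.List using (List; []; _∷_; _++_; length; replicate; drop; take)
open import Data.List.Properties using (length-drop; length-++-comm; take++drop≡id)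
open import Data.List.Relation.Unary.All as All using (All; []; _∷_)
import Data.List.Relation.Unary.All.Properties as AllP
import Data.Vec as Vec
open import Data.Vec.Properties using (tabulate-cong)
open import Data.Product as Product using (Σ; _×_; _,_; proj₁; proj₂)
open import Data.Product.Function.NonDependent.Propositional using (_×-↔_)
open import Data.Product.Function.Dependent.Propositional using (Σ-↔)
open import Data.Sum using (_⊎_; inj₁; inj₂)
open import Data.Sum.Function.Propositional using (_⊎-↔_)
open import Data.Unit using (⊤; tt)
open import Function.Base using (_∘_)
open import Function.Bundles using (_↔_; Inverse; Injection; mk↔ₛ′)
open import Function.Properties.Inverse using (↔-refl; ↔-sym; ↔-trans; ↔⇒↣)
open import Relation.Binary using (tri<; tri≈; tri>)
open import Relation.Binary.PropositionalEquality
  using (_≡_; refl; sym; trans; cong; cong₂; subst; subst₂; module ≡-Reasoning)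
open import Relation.Nullary using (yes; no; contradiction)
open import Relation.Nullary.Irrelevant using (Irrelevant)
import Relation.Unary as U
open import Axiom.UniquenessOfIdentityProofs using (module Decidable⇒UIP)

Fin-card : ∀ {a b} → Fin a ↔ Fin b → a ≡ b
Fin-card I = cantor-schröder-bernstein
  (Injection.injective (↔⇒↣ I)) (Injection.injective (↔⇒↣ (↔-sym I)))

Fin-cong : ∀ {a b} → a ≡ b → Fin a ↔ Fin b
Fin-cong refl = ↔-refl

Σ-Fin↔Fin-sumFin : ∀ n (f : Fin n → ℕ) → Σ (Fin n) (Fin ∘ f) ↔ Fin (sumFin n f)
Σ-Fin↔Fin-sumFin zero    f = mk↔ₛ′ (λ { (() , _) }) (λ ()) (λ ()) (λ { (() , _) })
Σ-Fin↔Fin-sumFin (suc n) f =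
  ↔-trans split (↔-trans (↔-refl ⊎-↔ Σ-Fin↔Fin-sumFin n (f ∘ Fin.suc)) (↔-sym +↔⊎))
  where
  to : Σ (Fin (suc n)) (Fin ∘ f) → Fin (f Fin.zero) ⊎ Σ (Fin n) (Fin ∘ f ∘ Fin.suc)
  to (Fin.zero  , x) = inj₁ x
  to (Fin.suc i , x) = inj₂ (i , x)
  from : Fin (f Fin.zero) ⊎ Σ (Fin n) (Fin ∘ f ∘ Fin.suc) → Σ (Fin (suc n)) (Fin ∘ f)
  from (inj₁ x)       = Fin.zero , x
  from (inj₂ (i , x)) = Fin.suc i , x
  to-from : ∀ y → to (from y) ≡ y
  to-from (inj₁ _) = refl
  to-from (inj₂ _) = refl
  from-to : ∀ x → from (to x) ≡ x
  from-to (Fin.zero  , _) = refl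
  from-to (Fin.suc _ , _) = refl
  split = mk↔ₛ′ to from to-from from-to

Σ-×-swap : ∀ {A B : Set} (C : A × B → Set) → Σ (A × B) C ↔ Σ B (λ b → Σ A (λ a → C (a , b)))
Σ-×-swap C = mk↔ₛ′ (λ { ((a , b) , c) → b , a , c }) (λ { (b , a , c) → (a , b) , c })
  (λ _ → refl) (λ _ → refl)

Σ-≡-irrelevant : ∀ {A : Set} {P : A → Set} → U.Irrelevant P →
                 ∀ {a b} {p : P a} {q : P b} → a ≡ b → _≡_ {A = Σ A P} (a , p) (b , q)
Σ-≡-irrelevant irr {p = p} {q} refl = cong (_ ,_) (irr p q)

Σ-Fin-≡ : ∀ {A : Set} {f : A → ℕ} {a b : A} {i : Fin (f a)} {j : Fin (f b)} →
          a ≡ b → toℕ i ≡ toℕ j → _≡_ {A = Σ A (Fin ∘ f)} (a , i) (b , j)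
Σ-Fin-≡ refl eq = cong (_ ,_) (toℕ-injective eq)

×-irrelevant : ∀ {A B : Set} → Irrelevant A → Irrelevant B → Irrelevant (A × B)
×-irrelevant irrA irrB (a , b) (a′ , b′) = cong₂ _,_ (irrA a a′) (irrB b b′)

≡ℤ-irrelevant : ∀ {x y : ℤ} → Irrelevant (x ≡ y)
≡ℤ-irrelevant = Decidable⇒UIP.≡-irrelevant ℤP._≟_

x+y≡z⇒y≡z-x : ∀ {x y z : ℤ} → x ℤ.+ y ≡ z → y ≡ z ℤ.- x
x+y≡z⇒y≡z-x {x} {y} eq = trans (y≡[x+y]-x x y) (cong (ℤ._- x) eq)
  where
  y≡[x+y]-x : ∀ x y → y ≡ (x ℤ.+ y) ℤ.- x
  y≡[x+y]-x = solve-∀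

Block : Set
Block = ℤ × ℕ

verticals : ℕ → List Step
verticals a = replicate a V

blockSteps : List Block → List Step
blockSteps []             = []
blockSteps ((k , a) ∷ bs) = S k ∷ verticals a ++ blockSteps bs

compose : ℕ × List Block → List Step
compose (a , bs) = verticals a ++ blockSteps bs

decompose : List Step → ℕ × List Block
decompose []         = 0 , []
decompose (V ∷ ps)   = Product.map₁ suc (decompose ps)
decompose (S k ∷ ps) = 0 , (k , proj₁ (decompose ps)) ∷ proj₂ (decompose ps)

compose-decompose : ∀ ps → compose (decompose ps) ≡ ps
compose-decompose []         = refl
compose-decompose (V ∷ ps)   = cong (V ∷_) (compose-decompose ps)
compose-decompose (S k ∷ ps) = cong (S k ∷_) (compose-decompose ps)

decompose-compose : ∀ a bs → decompose (compose (a , bs)) ≡ (a , bs)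
decompose-compose (suc a) bs             rewrite decompose-compose a bs = refl
decompose-compose zero    []             = refl
decompose-compose zero    ((k , b) ∷ bs) rewrite decompose-compose b bs = refl

decomposition : (ℕ × List Block) ↔ List Step
decomposition = mk↔ₛ′ compose decompose compose-decompose (λ (a , bs) → decompose-compose a bs)

blocks : List Step → List Block
blocks ps = proj₂ (decompose ps)

blockSteps-blocks : ∀ k ps → blockSteps (blocks (S k ∷ ps)) ≡ S k ∷ ps
blockSteps-blocks k ps = compose-decompose (S k ∷ ps)

blocks-blockSteps : ∀ bs → blocks (blockSteps bs) ≡ bs
blocks-blockSteps bs = cong proj₂ (decompose-compose 0 bs)

rise : Block → ℤ
rise (k , a) = k ℤ.- + a

netRise : List Block → ℤ
netRise []       = 0ℤ
netRise (b ∷ bs) = rise b ℤ.+ netRise bs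

verticalTotal : List Block → ℕ
verticalTotal []             = 0
verticalTotal ((_ , a) ∷ bs) = a + verticalTotal bs

Allowed : (ℤ → Bool) → Block → Set
Allowed s (k , _) = T (s k)

endX-verticals-++ : ∀ a ps → endX (verticals a ++ ps) ≡ endX ps
endX-verticals-++ zero    ps = refl
endX-verticals-++ (suc a) ps = endX-verticals-++ a ps

endX-blockSteps : ∀ bs → endX (blockSteps bs) ≡ length bs
endX-blockSteps []             = refl
endX-blockSteps ((k , a) ∷ bs) =
  cong suc (trans (endX-verticals-++ a (blockSteps bs)) (endX-blockSteps bs))

endY-++ : ∀ xs ys → endY (xs ++ ys) ≡ endY xs ℤ.+ endY ys
endY-++ []       ys = sym (ℤP.+-identityˡ _)
endY-++ (p ∷ xs) ys =
  trans (cong (ℤ._+_ (dy p)) (endY-++ xs ys)) (sym (ℤP.+-assoc (dy p) (endY xs) (endY ys)))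

endY-verticals : ∀ a → endY (verticals a) ≡ - + a
endY-verticals zero          = refl
endY-verticals (suc zero)    = refl
endY-verticals (suc (suc a)) rewrite endY-verticals (suc a) = refl

endY-after-block : ∀ y k a → y ℤ.+ k ℤ.+ endY (verticals a) ≡ y ℤ.+ rise (k , a)
endY-after-block y k a =
  trans (cong (ℤ._+_ (y ℤ.+ k)) (endY-verticals a)) (ℤP.+-assoc y k (- + a))

endY-blockSteps : ∀ bs → endY (blockSteps bs) ≡ netRise bs
endY-blockSteps []             = refl
endY-blockSteps ((k , a) ∷ bs) = begin
  k ℤ.+ endY (verticals a ++ blockSteps bs)
    ≡⟨ cong (ℤ._+_ k) (endY-++ (verticals a) (blockSteps bs)) ⟩
  k ℤ.+ (endY (verticals a) ℤ.+ endY (blockSteps bs))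
    ≡⟨ cong (ℤ._+_ k) (cong₂ ℤ._+_ (endY-verticals a) (endY-blockSteps bs)) ⟩
  k ℤ.+ (- + a ℤ.+ netRise bs)
    ≡⟨ sym (ℤP.+-assoc k (- + a) (netRise bs)) ⟩
  rise (k , a) ℤ.+ netRise bs ∎
  where open ≡-Reasoning

countV-verticals-++ : ∀ a ps → countV (verticals a ++ ps) ≡ a + countV ps
countV-verticals-++ zero    ps = refl
countV-verticals-++ (suc a) ps = cong suc (countV-verticals-++ a ps)

countV-blockSteps : ∀ bs → countV (blockSteps bs) ≡ verticalTotal bs
countV-blockSteps []             = refl
countV-blockSteps ((k , a) ∷ bs) =
  trans (countV-verticals-++ a (blockSteps bs)) (cong (_+_ a) (countV-blockSteps bs))

All-blockSteps⁺ : ∀ {s} bs → All (Allowed s) bs → All (InV s) (blockSteps bs)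
All-blockSteps⁺ []             []      = []
All-blockSteps⁺ ((k , a) ∷ bs) (t ∷ h) = t ∷ AllP.++⁺ (AllP.replicate⁺ a tt) (All-blockSteps⁺ bs h)

All-blockSteps⁻ : ∀ {s} bs → All (InV s) (blockSteps bs) → All (Allowed s) bs
All-blockSteps⁻ []             _       = []
All-blockSteps⁻ ((k , a) ∷ bs) (t ∷ h) = t ∷ All-blockSteps⁻ bs (AllP.++⁻ʳ (verticals a) h)

PathTo : (ℤ → Bool) → ℕ → ℕ → List Step → Set
PathTo s m n ps = All (InV s) ps × endX ps ≡ n × endY ps ≡ - (+ m)

BlockPath : (ℤ → Bool) → ℕ → ℕ → ℕ × List Block → Set
BlockPath s m n (a , bs) = length bs ≡ n × All (Allowed s) bs × - + a ℤ.+ netRise bs ≡ - + m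

blockPath⇒pathTo : ∀ {s m n} a bs → BlockPath s m n (a , bs) → PathTo s m n (compose (a , bs))
blockPath⇒pathTo a bs (len , allowed , height) =
  AllP.++⁺ (AllP.replicate⁺ a tt) (All-blockSteps⁺ bs allowed) ,
  trans (endX-verticals-++ a (blockSteps bs)) (trans (endX-blockSteps bs) len) ,
  trans (endY-++ (verticals a) (blockSteps bs))
        (trans (cong₂ ℤ._+_ (endY-verticals a) (endY-blockSteps bs)) height)

pathTo⇒blockPath : ∀ {s m n} a bs → PathTo s m n (compose (a , bs)) → BlockPath s m n (a , bs)
pathTo⇒blockPath a bs (allowed , x , y) =
  trans (sym (endX-blockSteps bs)) (trans (sym (endX-verticals-++ a (blockSteps bs))) x) ,
  All-blockSteps⁻ bs (AllP.++⁻ʳ (verticals a) allowed) ,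
  trans (sym (cong₂ ℤ._+_ (endY-verticals a) (endY-blockSteps bs)))
        (trans (sym (endY-++ (verticals a) (blockSteps bs))) y)

InV-irrelevant : ∀ {s} → U.Irrelevant (InV s)
InV-irrelevant {x = V}   tt tt = refl
InV-irrelevant {x = S k} p  q  = T-irrelevant p q

pathTo-irrelevant : ∀ {s m n} → U.Irrelevant (PathTo s m n)
pathTo-irrelevant {s} =
  ×-irrelevant (All.irrelevant (λ {x} → InV-irrelevant {s} {x}))
               (×-irrelevant ℕP.≡-irrelevant ≡ℤ-irrelevant)

blockPath-irrelevant : ∀ {s m n} x → Irrelevant (BlockPath s m n x)
blockPath-irrelevant _ =
  ×-irrelevant ℕP.≡-irrelevant (×-irrelevant (All.irrelevant T-irrelevant) ≡ℤ-irrelevant)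

F↔blockPaths : ∀ s m n → F s m n ↔ Σ (ℕ × List Block) (BlockPath s m n)
F↔blockPaths s m n = ↔-sym (Σ-↔ decomposition (λ {(a , bs)} → mk↔ₛ′
  (blockPath⇒pathTo a bs) (pathTo⇒blockPath a bs)
  (λ _ → pathTo-irrelevant _ _) (λ _ → blockPath-irrelevant (a , bs) _ _)))

Ballot : ℤ → List Block → Set
Ballot y []       = ⊤
Ballot y (b ∷ bs) = 0ℤ ℤ.≤ y × Ballot (y ℤ.+ rise b) bs

ballot-irrelevant : ∀ y bs → Irrelevant (Ballot y bs)
ballot-irrelevant y []       tt       tt         = refl
ballot-irrelevant y (b ∷ bs) (p , q) (p′ , q′) =
  cong₂ _,_ (ℤP.≤-irrelevant p p′) (ballot-irrelevant _ bs q q′)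

aboveExceptLast-irrelevant : ∀ y ps → Irrelevant (AboveExceptLast y ps)
aboveExceptLast-irrelevant y []       tt       tt         = refl
aboveExceptLast-irrelevant y (p ∷ ps) (h , k) (h′ , k′) =
  cong₂ _,_ (ℤP.≤-irrelevant h h′) (aboveExceptLast-irrelevant _ ps k k′)

aboveExceptLast-++⁻ʳ : ∀ y xs ys → AboveExceptLast y (xs ++ ys) → AboveExceptLast (y ℤ.+ endY xs) ys
aboveExceptLast-++⁻ʳ y []       ys h       = subst (λ z → AboveExceptLast z ys) (sym (ℤP.+-identityʳ y)) h
aboveExceptLast-++⁻ʳ y (p ∷ xs) ys (_ , h) =
  subst (λ z → AboveExceptLast z ys) (ℤP.+-assoc y (dy p) (endY xs))
        (aboveExceptLast-++⁻ʳ (y ℤ.+ dy p) xs ys h)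

-- The end point of xs is checked by xs ++ ys exactly when ys is non-empty,
-- which is exactly when AboveExceptLast checks the start of ys.
aboveExceptLast-++⁺ : ∀ y xs ys → AboveExceptLast y xs → AboveExceptLast (y ℤ.+ endY xs) ys →
                      AboveExceptLast y (xs ++ ys)
aboveExceptLast-++⁺ y []       ys _        h = subst (λ z → AboveExceptLast z ys) (ℤP.+-identityʳ y) h
aboveExceptLast-++⁺ y (p ∷ xs) ys (0≤y , hxs) h =
  0≤y , aboveExceptLast-++⁺ (y ℤ.+ dy p) xs ys hxs
          (subst (λ z → AboveExceptLast z ys) (sym (ℤP.+-assoc y (dy p) (endY xs))) h)

aboveExceptLast-verticals : ∀ a z → -1ℤ ℤ.≤ z ℤ.+ endY (verticals a) → AboveExceptLast z (verticals a)
aboveExceptLast-verticals zero    z _ = tt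
aboveExceptLast-verticals (suc a) z h =
  ℤP.i<j⇒suc[i]≤j (ℤP.≤-<-trans h descends) ,
  aboveExceptLast-verticals a (z ℤ.+ -1ℤ) (subst (-1ℤ ℤ.≤_) (sym (ℤP.+-assoc z -1ℤ _)) h)
  where
  descends : z ℤ.+ endY (verticals (suc a)) ℤ.< z
  descends = subst₂ ℤ._<_ (cong (ℤ._+_ z) (sym (endY-verticals (suc a)))) (ℤP.+-identityʳ z)
                    (ℤP.+-monoʳ-< z ℤ.-<+)

ballot-start : ∀ y bs → Ballot y bs → -1ℤ ℤ.≤ y ℤ.+ netRise bs → -1ℤ ℤ.≤ y
ballot-start y []      _        h = subst (-1ℤ ℤ.≤_) (ℤP.+-identityʳ y) h
ballot-start y (_ ∷ _) (0≤y , _) _ = ℤP.≤-trans (ℤP.<⇒≤ ℤ.-<+) 0≤y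

ballot⇒aboveExceptLast : ∀ y bs → Ballot y bs → -1ℤ ℤ.≤ y ℤ.+ netRise bs →
                         AboveExceptLast y (blockSteps bs)
ballot⇒aboveExceptLast y []             _            _   = tt
ballot⇒aboveExceptLast y ((k , a) ∷ bs) (0≤y , ballot) end =
  0≤y , aboveExceptLast-++⁺ (y ℤ.+ k) (verticals a) (blockSteps bs)
          (aboveExceptLast-verticals a (y ℤ.+ k)
            (subst (-1ℤ ℤ.≤_) (sym (endY-after-block y k a)) (ballot-start y′ bs ballot end′)))
          (subst (λ z → AboveExceptLast z (blockSteps bs)) (sym (endY-after-block y k a))
            (ballot⇒aboveExceptLast y′ bs ballot end′))
  where
  y′ = y ℤ.+ rise (k , a)
  end′ : -1ℤ ℤ.≤ y′ ℤ.+ netRise bs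
  end′ = subst (-1ℤ ℤ.≤_) (sym (ℤP.+-assoc y (rise (k , a)) (netRise bs))) end

aboveExceptLast⇒ballot : ∀ y bs → AboveExceptLast y (blockSteps bs) → Ballot y bs
aboveExceptLast⇒ballot y []             _         = tt
aboveExceptLast⇒ballot y ((k , a) ∷ bs) (0≤y , h) =
  0≤y , aboveExceptLast⇒ballot (y ℤ.+ rise (k , a)) bs
          (subst (λ z → AboveExceptLast z (blockSteps bs)) (endY-after-block y k a)
            (aboveExceptLast-++⁻ʳ (y ℤ.+ k) (verticals a) (blockSteps bs) h))

prefixRise : List Block → ℕ → ℤ
prefixRise _        zero    = 0ℤ
prefixRise []       (suc l) = 0ℤ
prefixRise (b ∷ bs) (suc l) = rise b ℤ.+ prefixRise bs l

NonnegativePrefixes : List Block → Set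
NonnegativePrefixes bs = ∀ {l} → l < length bs → 0ℤ ℤ.≤ prefixRise bs l

ballot⇒nonnegativePrefixes : ∀ bs → Ballot 0ℤ bs → NonnegativePrefixes bs
ballot⇒nonnegativePrefixes bs ballot l<n = subst (0ℤ ℤ.≤_) (ℤP.+-identityˡ _) (from 0ℤ bs ballot l<n)
  where
  from : ∀ y bs → Ballot y bs → ∀ {l} → l < length bs → 0ℤ ℤ.≤ y ℤ.+ prefixRise bs l
  from y (b ∷ bs) (0≤y , _) {zero} _ = subst (0ℤ ℤ.≤_) (sym (ℤP.+-identityʳ y)) 0≤y
  from y (b ∷ bs) (_ , ballot) {suc l} (s≤s l<n) =
    subst (0ℤ ℤ.≤_) (ℤP.+-assoc y (rise b) (prefixRise bs l)) (from (y ℤ.+ rise b) bs ballot l<n)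

nonnegativePrefixes⇒ballot : ∀ bs → NonnegativePrefixes bs → Ballot 0ℤ bs
nonnegativePrefixes⇒ballot bs nonneg =
  to 0ℤ bs (λ l<n → subst (0ℤ ℤ.≤_) (sym (ℤP.+-identityˡ _)) (nonneg l<n))
  where
  to : ∀ y bs → (∀ {l} → l < length bs → 0ℤ ℤ.≤ y ℤ.+ prefixRise bs l) → Ballot y bs
  to y []       _      = tt
  to y (b ∷ bs) nonneg =
    subst (0ℤ ℤ.≤_) (ℤP.+-identityʳ y) (nonneg (s≤s z≤n)) ,
    to (y ℤ.+ rise b) bs
      (λ l<n → subst (0ℤ ℤ.≤_) (sym (ℤP.+-assoc y (rise b) _)) (nonneg (s≤s l<n)))

netRise-++ : ∀ xs ys → netRise (xs ++ ys) ≡ netRise xs ℤ.+ netRise ys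
netRise-++ []       ys = sym (ℤP.+-identityˡ _)
netRise-++ (x ∷ xs) ys =
  trans (cong (ℤ._+_ (rise x)) (netRise-++ xs ys)) (sym (ℤP.+-assoc (rise x) (netRise xs) (netRise ys)))

netRise-drop : ∀ j bs → netRise bs ≡ prefixRise bs j ℤ.+ netRise (drop j bs)
netRise-drop zero    bs       = sym (ℤP.+-identityˡ _)
netRise-drop (suc j) []       = refl
netRise-drop (suc j) (b ∷ bs) =
  trans (cong (ℤ._+_ (rise b)) (netRise-drop j bs))
        (sym (ℤP.+-assoc (rise b) (prefixRise bs j) (netRise (drop j bs))))

prefixRise-[] : ∀ l → prefixRise [] l ≡ 0ℤ
prefixRise-[] zero    = refl
prefixRise-[] (suc l) = refl

prefixRise-+ : ∀ j l bs → prefixRise bs (j + l) ≡ prefixRise bs j ℤ.+ prefixRise (drop j bs) l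
prefixRise-+ zero    l bs       = sym (ℤP.+-identityˡ _)
prefixRise-+ (suc j) l []       = sym (trans (ℤP.+-identityˡ _) (prefixRise-[] l))
prefixRise-+ (suc j) l (b ∷ bs) =
  trans (cong (ℤ._+_ (rise b)) (prefixRise-+ j l bs))
        (sym (ℤP.+-assoc (rise b) (prefixRise bs j) (prefixRise (drop j bs) l)))

prefixRise-++ˡ : ∀ xs ys l → l ≤ length xs → prefixRise (xs ++ ys) l ≡ prefixRise xs l
prefixRise-++ˡ []       ys zero    _         = refl
prefixRise-++ˡ (x ∷ xs) ys zero    _         = refl
prefixRise-++ˡ (x ∷ xs) ys (suc l) (s≤s l≤n) = cong (ℤ._+_ (rise x)) (prefixRise-++ˡ xs ys l l≤n)

prefixRise-++ʳ : ∀ xs ys l → prefixRise (xs ++ ys) (length xs + l) ≡ netRise xs ℤ.+ prefixRise ys l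
prefixRise-++ʳ []       ys l = sym (ℤP.+-identityˡ _)
prefixRise-++ʳ (x ∷ xs) ys l =
  trans (cong (ℤ._+_ (rise x)) (prefixRise-++ʳ xs ys l))
        (sym (ℤP.+-assoc (rise x) (netRise xs) (prefixRise ys l)))

prefixRise-take : ∀ j bs l → l ≤ j → prefixRise (take j bs) l ≡ prefixRise bs l
prefixRise-take j       bs       zero    _         = refl
prefixRise-take (suc j) []       (suc l) _         = refl
prefixRise-take (suc j) (b ∷ bs) (suc l) (s≤s l≤j) = cong (ℤ._+_ (rise b)) (prefixRise-take j bs l l≤j)

rotate : ∀ {A : Set} → ℕ → List A → List A
rotate j xs = drop j xs ++ take j xs

length-rotate : ∀ {A : Set} j (xs : List A) → length (rotate j xs) ≡ length xs
length-rotate j xs = trans (length-++-comm (drop j xs) (take j xs)) (cong length (take++drop≡id j xs))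

drop-length-++ : ∀ {A : Set} (xs ys : List A) → drop (length xs) (xs ++ ys) ≡ ys
drop-length-++ []       ys = refl
drop-length-++ (x ∷ xs) ys = drop-length-++ xs ys

take-length-++ : ∀ {A : Set} (xs ys : List A) → take (length xs) (xs ++ ys) ≡ xs
take-length-++ []       ys = refl
take-length-++ (x ∷ xs) ys = cong (x ∷_) (take-length-++ xs ys)

rotate-rotate : ∀ {A : Set} j (xs : List A) → rotate (length xs ∸ j) (rotate j xs) ≡ xs
rotate-rotate j xs = begin
  rotate (length xs ∸ j) (rotate j xs)
    ≡⟨ cong (λ i → rotate i (rotate j xs)) (sym (length-drop j xs)) ⟩
  rotate (length (drop j xs)) (drop j xs ++ take j xs)
    ≡⟨ cong₂ _++_ (drop-length-++ (drop j xs) (take j xs)) (take-length-++ (drop j xs) (take j xs)) ⟩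
  take j xs ++ drop j xs
    ≡⟨ take++drop≡id j xs ⟩
  xs ∎
  where open ≡-Reasoning

All-rotate : ∀ {A : Set} {P : A → Set} j {xs} → All P xs → All P (rotate j xs)
All-rotate j all = AllP.++⁺ (AllP.drop⁺ j all) (AllP.take⁺ j all)

netRise-rotate : ∀ j bs → netRise (rotate j bs) ≡ netRise bs
netRise-rotate j bs = begin
  netRise (drop j bs ++ take j bs)      ≡⟨ netRise-++ (drop j bs) (take j bs) ⟩
  netRise (drop j bs) ℤ.+ netRise (take j bs) ≡⟨ ℤP.+-comm (netRise (drop j bs)) _ ⟩
  netRise (take j bs) ℤ.+ netRise (drop j bs) ≡⟨ sym (netRise-++ (take j bs) (drop j bs)) ⟩
  netRise (take j bs ++ drop j bs)      ≡⟨ cong netRise (take++drop≡id j bs) ⟩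
  netRise bs ∎
  where open ≡-Reasoning

prefixRise-rotate-≤ : ∀ j bs l → l ≤ length bs ∸ j →
                      prefixRise (rotate j bs) l ≡ prefixRise bs (j + l) ℤ.- prefixRise bs j
prefixRise-rotate-≤ j bs l l≤n∸j =
  trans (prefixRise-++ˡ (drop j bs) (take j bs) l (subst (l ≤_) (sym (length-drop j bs)) l≤n∸j))
        (x+y≡z⇒y≡z-x (sym (prefixRise-+ j l bs)))

prefixRise-rotate-> : ∀ j bs l → netRise bs ≡ -1ℤ → l ≤ j →
                      prefixRise (rotate j bs) (length bs ∸ j + l) ≡
                      prefixRise bs l ℤ.- (1ℤ ℤ.+ prefixRise bs j)
prefixRise-rotate-> j bs l word l≤j = begin
  prefixRise (rotate j bs) (length bs ∸ j + l)
    ≡⟨ cong (λ i → prefixRise (rotate j bs) (i + l)) (sym (length-drop j bs)) ⟩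
  prefixRise (drop j bs ++ take j bs) (length (drop j bs) + l)
    ≡⟨ prefixRise-++ʳ (drop j bs) (take j bs) l ⟩
  netRise (drop j bs) ℤ.+ prefixRise (take j bs) l
    ≡⟨ cong₂ ℤ._+_ (x+y≡z⇒y≡z-x {prefixRise bs j} (trans (sym (netRise-drop j bs)) word))
                   (prefixRise-take j bs l l≤j) ⟩
  (-1ℤ ℤ.- prefixRise bs j) ℤ.+ prefixRise bs l
    ≡⟨ rearrange (prefixRise bs j) (prefixRise bs l) ⟩
  prefixRise bs l ℤ.- (1ℤ ℤ.+ prefixRise bs j) ∎
  where
  open ≡-Reasoning
  rearrange : ∀ x y → (-1ℤ ℤ.- x) ℤ.+ y ≡ y ℤ.- (1ℤ ℤ.+ x)
  rearrange = solve-∀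

record IsFirstMinimum (f : ℕ → ℤ) (n j : ℕ) : Set where
  field
    bounded       : j < n
    minimal       : ∀ {t} → t < n → f j ℤ.≤ f t
    strictlyFirst : ∀ {t} → t < j → f j ℤ.< f t

open IsFirstMinimum

firstMinimum-unique : ∀ {f n i j} → IsFirstMinimum f n i → IsFirstMinimum f n j → i ≡ j
firstMinimum-unique {i = i} {j} mi mj with ℕP.<-cmp i j
... | tri< i<j _ _ = contradiction (minimal mi (bounded mj)) (ℤP.<⇒≱ (strictlyFirst mj i<j))
... | tri≈ _ i≡j _ = i≡j
... | tri> _ _ j<i = contradiction (minimal mj (bounded mi)) (ℤP.<⇒≱ (strictlyFirst mi j<i))

firstArgmin : (ℕ → ℤ) → ℕ → ℕ
firstArgmin f zero    = 0
firstArgmin f (suc m) with f (suc m) ℤP.<? f (firstArgmin f m)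
... | yes _ = suc m
... | no  _ = firstArgmin f m

firstArgmin-≤ : ∀ (f : ℕ → ℤ) m → firstArgmin f m ≤ m
firstArgmin-≤ f zero    = z≤n
firstArgmin-≤ f (suc m) with f (suc m) ℤP.<? f (firstArgmin f m)
... | yes _ = ℕP.≤-refl
... | no  _ = ℕP.m≤n⇒m≤1+n (firstArgmin-≤ f m)

firstArgmin-minimal : ∀ (f : ℕ → ℤ) m {t} → t ≤ m → f (firstArgmin f m) ℤ.≤ f t
firstArgmin-minimal f zero    z≤n = ℤP.≤-refl
firstArgmin-minimal f (suc m) t≤m
  with f (suc m) ℤP.<? f (firstArgmin f m) | ℕP.m≤n⇒m<n∨m≡n t≤m
... | yes _     | inj₂ refl = ℤP.≤-refl
... | yes fm<fa | inj₁ t<m  = ℤP.<⇒≤ (ℤP.<-≤-trans fm<fa (firstArgmin-minimal f m (ℕP.≤-pred t<m)))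
... | no  fm≮fa | inj₂ refl = ℤP.≮⇒≥ fm≮fa
... | no  _     | inj₁ t<m  = firstArgmin-minimal f m (ℕP.≤-pred t<m)

firstArgmin-strictlyFirst : ∀ (f : ℕ → ℤ) m {t} → t < firstArgmin f m → f (firstArgmin f m) ℤ.< f t
firstArgmin-strictlyFirst f (suc m) t<a with f (suc m) ℤP.<? f (firstArgmin f m)
... | yes fm<fa = ℤP.<-≤-trans fm<fa (firstArgmin-minimal f m (ℕP.≤-pred t<a))
... | no  _     = firstArgmin-strictlyFirst f m t<a

firstArgmin-isFirstMinimum : ∀ f m → IsFirstMinimum f (suc m) (firstArgmin f m)
firstArgmin-isFirstMinimum f m = record
  { bounded       = s≤s (firstArgmin-≤ f m)
  ; minimal       = λ t<n → firstArgmin-minimal f m (ℕP.≤-pred t<n)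
  ; strictlyFirst = firstArgmin-strictlyFirst f m
  }

module _ {bs : List Block} (word : netRise bs ≡ -1ℤ) where

  private
    n = length bs
    h = prefixRise bs

    n∸j+t<n : ∀ {j t} → j ≤ n → t < j → n ∸ j + t < n
    n∸j+t<n {j} j≤n t<j = subst (n ∸ j + _ <_) (ℕP.m∸n+n≡m j≤n) (ℕP.+-monoʳ-< (n ∸ j) t<j)

    nonnegativePrefixes-rotate : ∀ {j} → Ballot 0ℤ (rotate j bs) → ∀ {l} → l < n →
                                 0ℤ ℤ.≤ prefixRise (rotate j bs) l
    nonnegativePrefixes-rotate {j} ballot l<n =
      ballot⇒nonnegativePrefixes (rotate j bs) ballot (subst (_ <_) (sym (length-rotate j bs)) l<n)

  ballot-rotate⇒firstMinimum : ∀ {j} → j < n → Ballot 0ℤ (rotate j bs) → IsFirstMinimum h n j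
  ballot-rotate⇒firstMinimum {j} j<n ballot = record
    { bounded = j<n ; minimal = minimal′ ; strictlyFirst = strictlyFirst′ }
    where
    strictlyFirst′ : ∀ {t} → t < j → h j ℤ.< h t
    strictlyFirst′ {t} t<j = ℤP.suc[i]≤j⇒i<j (ℤP.0≤i-j⇒j≤i
      (subst (0ℤ ℤ.≤_) (prefixRise-rotate-> j bs t word (ℕP.<⇒≤ t<j))
        (nonnegativePrefixes-rotate {j} ballot (n∸j+t<n (ℕP.<⇒≤ j<n) t<j))))
    later : ∀ {t} → j ≤ t → t < n → h j ℤ.≤ h t
    later {t} j≤t t<n = ℤP.0≤i-j⇒j≤i
      (subst (0ℤ ℤ.≤_)
        (trans (prefixRise-rotate-≤ j bs (t ∸ j) (ℕP.∸-monoˡ-≤ j (ℕP.<⇒≤ t<n)))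
               (cong (λ i → h i ℤ.- h j) (ℕP.m+[n∸m]≡n j≤t)))
        (nonnegativePrefixes-rotate {j} ballot (ℕP.≤-<-trans (ℕP.m∸n≤m t j) t<n)))
    minimal′ : ∀ {t} → t < n → h j ℤ.≤ h t
    minimal′ {t} t<n with t ℕP.<? j
    ... | yes t<j = ℤP.<⇒≤ (strictlyFirst′ t<j)
    ... | no  t≮j = later (ℕP.≮⇒≥ t≮j) t<n

  firstMinimum⇒ballot-rotate : ∀ {j} → IsFirstMinimum h n j → Ballot 0ℤ (rotate j bs)
  firstMinimum⇒ballot-rotate {j} min = nonnegativePrefixes⇒ballot (rotate j bs)
    (λ l<n → nonneg (subst (_ <_) (length-rotate j bs) l<n))
    where
    j≤n = ℕP.<⇒≤ (bounded min)
    nonneg : ∀ {l} → l < n → 0ℤ ℤ.≤ prefixRise (rotate j bs) l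
    nonneg {l} l<n with l ℕP.<? n ∸ j
    ... | yes l<n∸j = subst (0ℤ ℤ.≤_) (sym (prefixRise-rotate-≤ j bs l (ℕP.<⇒≤ l<n∸j)))
      (ℤP.i≤j⇒0≤j-i (minimal min (subst (j + l <_) (ℕP.m+[n∸m]≡n j≤n) (ℕP.+-monoʳ-< j l<n∸j))))
    ... | no  l≮n∸j = subst (0ℤ ℤ.≤_)
      (sym (trans (cong (prefixRise (rotate j bs)) l≡) (prefixRise-rotate-> j bs t word (ℕP.<⇒≤ t<j))))
      (ℤP.i≤j⇒0≤j-i (ℤP.i<j⇒suc[i]≤j (strictlyFirst min t<j)))
      where
      t = l ∸ (n ∸ j)
      l≡ : l ≡ n ∸ j + t
      l≡ = sym (ℕP.m+[n∸m]≡n (ℕP.≮⇒≥ l≮n∸j))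
      t<j : t < j
      t<j = ℕP.+-cancelˡ-< (n ∸ j) t j (subst₂ _<_ l≡ (sym (ℕP.m∸n+n≡m j≤n)) l<n)

IsWord : (ℤ → Bool) → ℕ → List Block → Set
IsWord s n bs = length bs ≡ n × All (Allowed s) bs × netRise bs ≡ -1ℤ

Word : (ℤ → Bool) → ℕ → Set
Word s n = Σ (List Block) (IsWord s n)

BallotWord : (ℤ → Bool) → ℕ → Set
BallotWord s n = Σ (List Block) (λ bs → IsWord s n bs × Ballot 0ℤ bs)

isWord-irrelevant : ∀ {s n} → U.Irrelevant (IsWord s n)
isWord-irrelevant =
  ×-irrelevant ℕP.≡-irrelevant (×-irrelevant (All.irrelevant T-irrelevant) ≡ℤ-irrelevant)

isBallotWord-irrelevant : ∀ {s n} → U.Irrelevant (λ bs → IsWord s n bs × Ballot 0ℤ bs)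
isBallotWord-irrelevant {x = bs} = ×-irrelevant isWord-irrelevant (ballot-irrelevant 0ℤ bs)

isWord-rotate : ∀ {s n} j bs → IsWord s n bs → IsWord s n (rotate j bs)
isWord-rotate j bs (len , allowed , net) =
  trans (length-rotate j bs) len , All-rotate j allowed , trans (netRise-rotate j bs) net

isWord⇒pathTo : ∀ {s n} bs → IsWord s n bs → PathTo s 1 n (blockSteps bs)
isWord⇒pathTo bs (len , allowed , net) =
  blockPath⇒pathTo 0 bs (len , allowed , trans (ℤP.+-identityˡ _) net)

pathTo⇒isWord : ∀ {s n} bs → PathTo s 1 n (blockSteps bs) → IsWord s n bs
pathTo⇒isWord bs path with pathTo⇒blockPath 0 bs path
... | len , allowed , net = len , allowed , trans (sym (ℤP.+-identityˡ _)) net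

-1+x≡-1⇒x≡0 : ∀ {x} → -1ℤ ℤ.+ x ≡ -1ℤ → x ≡ 0ℤ
-1+x≡-1⇒x≡0 = x+y≡z⇒y≡z-x { -1ℤ}

F₁↔F₀⊎Word : ∀ s n → F s 1 n ↔ (F s 0 n ⊎ Word s n)
F₁↔F₀⊎Word s n = mk↔ₛ′ to from to-from from-to
  where
  to : F s 1 n → F s 0 n ⊎ Word s n
  to ([]       , _      , _  , ())
  to (V ∷ ps   , _ ∷ al , ex , ey) = inj₁ (ps , al , ex , -1+x≡-1⇒x≡0 ey)
  to (S k ∷ ps , path)             = inj₂ (blocks (S k ∷ ps) ,
    pathTo⇒isWord _ (subst (PathTo s 1 n) (sym (blockSteps-blocks k ps)) path))

  from : F s 0 n ⊎ Word s n → F s 1 n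
  from (inj₁ (ps , al , ex , ey)) = V ∷ ps , tt ∷ al , ex , cong (ℤ._+_ -1ℤ) ey
  from (inj₂ (bs , word))         = blockSteps bs , isWord⇒pathTo bs word

  to-from : ∀ y → to (from y) ≡ y
  to-from (inj₁ _)                      = cong inj₁ (Σ-≡-irrelevant (pathTo-irrelevant {s} {0} {n}) refl)
  to-from (inj₂ ([]    , _ , _ , ()))
  to-from (inj₂ (b ∷ bs , _))           =
    cong inj₂ (Σ-≡-irrelevant isWord-irrelevant (blocks-blockSteps (b ∷ bs)))

  from-to : ∀ x → from (to x) ≡ x
  from-to ([]       , _      , _ , ())
  from-to (V ∷ ps   , _ ∷ _  , _)     = Σ-≡-irrelevant pathTo-irrelevant refl
  from-to (S k ∷ ps , _)              = Σ-≡-irrelevant pathTo-irrelevant (blockSteps-blocks k ps)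

BallotWord↔P : ∀ s m → BallotWord s (suc m) ↔ P s 1 (suc m)
BallotWord↔P s m = mk↔ₛ′ to from to-from from-to
  where
  to : BallotWord s (suc m) → P s 1 (suc m)
  to (bs , word , ballot) = blockSteps bs , isWord⇒pathTo bs word ,
    ballot⇒aboveExceptLast 0ℤ bs ballot
      (ℤP.≤-reflexive (sym (trans (ℤP.+-identityˡ _) (proj₂ (proj₂ word)))))

  from : P s 1 (suc m) → BallotWord s (suc m)
  from ([]           , (_ , _  , ()) , _)
  from (V ∷ []       , (_ , () , _)  , _)
  from (V ∷ _ ∷ _    , _             , (_ , () , _))
  from (S k ∷ ps     , path          , above) =
    blocks (S k ∷ ps) ,
    pathTo⇒isWord _ (subst (PathTo s 1 (suc m)) (sym (blockSteps-blocks k ps)) path) ,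
    aboveExceptLast⇒ballot 0ℤ (blocks (S k ∷ ps))
      (subst (AboveExceptLast 0ℤ) (sym (blockSteps-blocks k ps)) above)

  to-from : ∀ y → to (from y) ≡ y
  to-from ([]        , (_ , _  , ()) , _)
  to-from (V ∷ []    , (_ , () , _)  , _)
  to-from (V ∷ _ ∷ _ , _             , (_ , () , _))
  to-from (S k ∷ ps  , _) =
    Σ-≡-irrelevant (×-irrelevant pathTo-irrelevant (aboveExceptLast-irrelevant 0ℤ _)) (blockSteps-blocks k ps)

  from-to : ∀ x → from (to x) ≡ x
  from-to ([]     , (() , _) , _)
  from-to (b ∷ bs , _)        = Σ-≡-irrelevant isBallotWord-irrelevant (blocks-blockSteps (b ∷ bs))

-- The mark i stands for the rotation by i + 1 blocks, which puts block i of
-- the ballot word last.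
rotations↔words : ∀ s m → (Fin (suc m) × BallotWord s (suc m)) ↔ Word s (suc m)
rotations↔words s m = mk↔ₛ′ to from to-from from-to
  where
  to : Fin (suc m) × BallotWord s (suc m) → Word s (suc m)
  to (i , bs , word , _) = rotate (suc (toℕ i)) bs , isWord-rotate (suc (toℕ i)) bs word

  start : List Block → ℕ
  start bs = firstArgmin (prefixRise bs) m

  start-isFirstMinimum : ∀ bs → length bs ≡ suc m → IsFirstMinimum (prefixRise bs) (length bs) (start bs)
  start-isFirstMinimum bs len = subst (λ n → IsFirstMinimum (prefixRise bs) n (start bs)) (sym len)
    (firstArgmin-isFirstMinimum (prefixRise bs) m)

  from : Word s (suc m) → Fin (suc m) × BallotWord s (suc m)
  from (bs , word) = fromℕ< (s≤s (ℕP.m∸n≤m m (start bs))) ,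
    rotate (start bs) bs , isWord-rotate (start bs) bs word ,
    firstMinimum⇒ballot-rotate (proj₂ (proj₂ word)) (start-isFirstMinimum bs (proj₁ word))

  to-from : ∀ y → to (from y) ≡ y
  to-from (bs , word) = Σ-≡-irrelevant isWord-irrelevant (begin
    rotate (suc (toℕ (fromℕ< _))) (rotate j bs)
      ≡⟨ cong (λ i → rotate (suc i) (rotate j bs)) (toℕ-fromℕ< _) ⟩
    rotate (suc (m ∸ j)) (rotate j bs)
      ≡⟨ cong (λ i → rotate i (rotate j bs)) (sym (ℕP.+-∸-assoc 1 (firstArgmin-≤ (prefixRise bs) m))) ⟩
    rotate (suc m ∸ j) (rotate j bs)
      ≡⟨ cong (λ n → rotate (n ∸ j) (rotate j bs)) (sym (proj₁ word)) ⟩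
    rotate (length bs ∸ j) (rotate j bs)
      ≡⟨ rotate-rotate j bs ⟩
    bs ∎)
    where
    open ≡-Reasoning
    j = start bs

  from-to : ∀ x → from (to x) ≡ x
  from-to (i , g , word , ballot) =
    cong₂ _,_ (toℕ-injective index≡) (Σ-≡-irrelevant isBallotWord-irrelevant rotation≡)
    where
    r = suc (toℕ i)
    bs = rotate r g
    len : length bs ≡ suc m
    len = trans (length-rotate r g) (proj₁ word)
    back : rotate (m ∸ toℕ i) bs ≡ g
    back = trans (cong (λ n → rotate (n ∸ r) bs) (sym (proj₁ word))) (rotate-rotate r g)
    start≡ : start bs ≡ m ∸ toℕ i
    start≡ = firstMinimum-unique (start-isFirstMinimum bs len)
      (ballot-rotate⇒firstMinimum (trans (netRise-rotate r g) (proj₂ (proj₂ word)))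
        (subst (m ∸ toℕ i <_) (sym len) (s≤s (ℕP.m∸n≤m m (toℕ i))))
        (subst (Ballot 0ℤ) (sym back) ballot))
    index≡ : toℕ (fromℕ< (s≤s (ℕP.m∸n≤m m (start bs)))) ≡ toℕ i
    index≡ = trans (toℕ-fromℕ< _)
                   (trans (cong (m ∸_) start≡) (ℕP.m∸[m∸n]≡n (ℕP.≤-pred (toℕ<n i))))
    rotation≡ : rotate (start bs) bs ≡ g
    rotation≡ = trans (cong (λ j → rotate j bs) start≡) back

lastRun : List Block → ℕ
lastRun []           = 0
lastRun (b ∷ [])     = proj₂ b
lastRun (_ ∷ b ∷ bs) = lastRun (b ∷ bs)

lengthenLastRun : ℕ → List Block → List Block
lengthenLastRun c []             = []
lengthenLastRun c ((k , a) ∷ []) = (k , c + a) ∷ []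
lengthenLastRun c (b ∷ b′ ∷ bs)  = b ∷ lengthenLastRun c (b′ ∷ bs)

shortenLastRun : ℕ → List Block → List Block
shortenLastRun c []             = []
shortenLastRun c ((k , a) ∷ []) = (k , a ∸ c) ∷ []
shortenLastRun c (b ∷ b′ ∷ bs)  = b ∷ shortenLastRun c (b′ ∷ bs)

length-lengthenLastRun : ∀ c bs → length (lengthenLastRun c bs) ≡ length bs
length-lengthenLastRun c []            = refl
length-lengthenLastRun c (_ ∷ [])      = refl
length-lengthenLastRun c (_ ∷ b ∷ bs)  = cong suc (length-lengthenLastRun c (b ∷ bs))

length-shortenLastRun : ∀ c bs → length (shortenLastRun c bs) ≡ length bs
length-shortenLastRun c []            = refl
length-shortenLastRun c (_ ∷ [])      = refl
length-shortenLastRun c (_ ∷ b ∷ bs)  = cong suc (length-shortenLastRun c (b ∷ bs))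

All-lengthenLastRun : ∀ {s} c {bs} → All (Allowed s) bs → All (Allowed s) (lengthenLastRun c bs)
All-lengthenLastRun c {[]}         []            = []
All-lengthenLastRun c {_ ∷ []}     (t ∷ [])      = t ∷ []
All-lengthenLastRun c {_ ∷ _ ∷ _}  (t ∷ allowed) = t ∷ All-lengthenLastRun c allowed

All-shortenLastRun : ∀ {s} c {bs} → All (Allowed s) bs → All (Allowed s) (shortenLastRun c bs)
All-shortenLastRun c {[]}         []            = []
All-shortenLastRun c {_ ∷ []}     (t ∷ [])      = t ∷ []
All-shortenLastRun c {_ ∷ _ ∷ _}  (t ∷ allowed) = t ∷ All-shortenLastRun c allowed

netRise-lengthenLastRun : ∀ c bs → 0 < length bs → netRise (lengthenLastRun c bs) ≡ - + c ℤ.+ netRise bs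
netRise-lengthenLastRun c ((k , a) ∷ [])    _ = last k (+ c) (+ a)
  where
  last : ∀ k c a → (k ℤ.- (c ℤ.+ a)) ℤ.+ 0ℤ ≡ - c ℤ.+ ((k ℤ.- a) ℤ.+ 0ℤ)
  last = solve-∀
netRise-lengthenLastRun c (b ∷ b′ ∷ bs) _ =
  trans (cong (ℤ._+_ (rise b)) (netRise-lengthenLastRun c (b′ ∷ bs) (s≤s z≤n)))
        (exchange (rise b) (- + c) (netRise (b′ ∷ bs)))
  where
  exchange : ∀ x y z → x ℤ.+ (y ℤ.+ z) ≡ y ℤ.+ (x ℤ.+ z)
  exchange = solve-∀

lastRun-lengthenLastRun : ∀ c bs → 0 < length bs → lastRun (lengthenLastRun c bs) ≡ c + lastRun bs
lastRun-lengthenLastRun c (_ ∷ [])     _ = refl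
lastRun-lengthenLastRun c (_ ∷ _ ∷ []) _ = refl
lastRun-lengthenLastRun c (_ ∷ b ∷ b′ ∷ bs) _ = lastRun-lengthenLastRun c (b ∷ b′ ∷ bs) (s≤s z≤n)

shorten-lengthenLastRun : ∀ c bs → shortenLastRun c (lengthenLastRun c bs) ≡ bs
shorten-lengthenLastRun c []                  = refl
shorten-lengthenLastRun c ((k , a) ∷ [])      = cong (λ x → (k , x) ∷ []) (ℕP.m+n∸m≡n c a)
shorten-lengthenLastRun c (b ∷ (k , a) ∷ [])  = cong (λ x → b ∷ (k , x) ∷ []) (ℕP.m+n∸m≡n c a)
shorten-lengthenLastRun c (b ∷ b′ ∷ b″ ∷ bs) =
  cong (b ∷_) (shorten-lengthenLastRun c (b′ ∷ b″ ∷ bs))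

lengthen-shortenLastRun : ∀ c bs → c ≤ lastRun bs → lengthenLastRun c (shortenLastRun c bs) ≡ bs
lengthen-shortenLastRun c []                  _   = refl
lengthen-shortenLastRun c ((k , a) ∷ [])      c≤a = cong (λ x → (k , x) ∷ []) (ℕP.m+[n∸m]≡n c≤a)
lengthen-shortenLastRun c (b ∷ (k , a) ∷ [])  c≤a = cong (λ x → b ∷ (k , x) ∷ []) (ℕP.m+[n∸m]≡n c≤a)
lengthen-shortenLastRun c (b ∷ b′ ∷ b″ ∷ bs) c≤a =
  cong (b ∷_) (lengthen-shortenLastRun c (b′ ∷ b″ ∷ bs) c≤a)

-- A path of F s 0 n is V^a followed by blocks of total rise a; moving a + 1
-- vertical steps to the end gives a word whose last run exceeds a.
blockPaths↔lastRunChoices : ∀ s m → Σ (ℕ × List Block) (BlockPath s 0 (suc m)) ↔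
                                    Σ (Word s (suc m)) (λ w → Fin (lastRun (proj₁ w)))
blockPaths↔lastRunChoices s m = mk↔ₛ′ to from to-from from-to
  where
  nonempty : ∀ bs → length bs ≡ suc m → 0 < length bs
  nonempty _ len = subst (0 <_) (sym len) (s≤s z≤n)

  neg-suc-+ : ∀ a x → - + suc a ℤ.+ x ≡ -1ℤ ℤ.+ (- + a ℤ.+ x)
  neg-suc-+ a x = shift (+ a) x
    where
    shift : ∀ y x → - (1ℤ ℤ.+ y) ℤ.+ x ≡ -1ℤ ℤ.+ (- y ℤ.+ x)
    shift = solve-∀

  to : Σ (ℕ × List Block) (BlockPath s 0 (suc m)) → Σ (Word s (suc m)) (λ w → Fin (lastRun (proj₁ w)))
  to ((a , bs) , len , allowed , height) =
    (lengthenLastRun (suc a) bs ,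
     trans (length-lengthenLastRun (suc a) bs) len ,
     All-lengthenLastRun (suc a) allowed ,
     trans (netRise-lengthenLastRun (suc a) bs (nonempty bs len))
           (trans (neg-suc-+ a (netRise bs)) (cong (ℤ._+_ -1ℤ) height))) ,
    fromℕ< (subst (a <_) (sym (lastRun-lengthenLastRun (suc a) bs (nonempty bs len)))
                  (s≤s (ℕP.m≤m+n a (lastRun bs))))

  from : Σ (Word s (suc m)) (λ w → Fin (lastRun (proj₁ w))) → Σ (ℕ × List Block) (BlockPath s 0 (suc m))
  from ((w , len , allowed , net) , j) =
    (a , bs) , trans (length-shortenLastRun (suc a) w) len , All-shortenLastRun (suc a) allowed ,
    -1+x≡-1⇒x≡0 (begin
      -1ℤ ℤ.+ (- + a ℤ.+ netRise bs)    ≡⟨ sym (neg-suc-+ a (netRise bs)) ⟩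
      - + suc a ℤ.+ netRise bs          ≡⟨ sym (netRise-lengthenLastRun (suc a) bs (nonempty bs len′)) ⟩
      netRise (lengthenLastRun (suc a) bs) ≡⟨ cong netRise (lengthen-shortenLastRun (suc a) w (toℕ<n j)) ⟩
      netRise w                          ≡⟨ net ⟩
      -1ℤ ∎)
    where
    open ≡-Reasoning
    a = toℕ j
    bs = shortenLastRun (suc a) w
    len′ : length bs ≡ suc m
    len′ = trans (length-shortenLastRun (suc a) w) len

  to-from : ∀ y → to (from y) ≡ y
  to-from ((w , word) , j) = Σ-Fin-≡ {f = lastRun ∘ proj₁}
    (Σ-≡-irrelevant isWord-irrelevant (lengthen-shortenLastRun (suc (toℕ j)) w (toℕ<n j)))
    (toℕ-fromℕ< _)

  from-to : ∀ x → from (to x) ≡ x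
  from-to ((a , bs) , path) = Σ-≡-irrelevant (λ {x} → blockPath-irrelevant {s} {0} {suc m} x)
    (cong₂ _,_ a′≡a (trans (cong (λ t → shortenLastRun (suc t) (lengthenLastRun (suc a) bs)) a′≡a)
                           (shorten-lengthenLastRun (suc a) bs)))
    where
    a′≡a : toℕ (proj₂ (to ((a , bs) , path))) ≡ a
    a′≡a = toℕ-fromℕ< _

lastRun-++-∷ : ∀ xs b bs → lastRun (xs ++ b ∷ bs) ≡ lastRun (b ∷ bs)
lastRun-++-∷ []            b bs = refl
lastRun-++-∷ (x ∷ [])      b bs = refl
lastRun-++-∷ (x ∷ x′ ∷ xs) b bs = lastRun-++-∷ (x′ ∷ xs) b bs

lastRun-prefixes : ∀ g → sumFin (length g) (λ i → lastRun (take (suc (toℕ i)) g)) ≡ verticalTotal g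
lastRun-prefixes []                = refl
lastRun-prefixes ((_ , a) ∷ [])    = refl
lastRun-prefixes ((_ , a) ∷ b ∷ g) = cong (_+_ a) (lastRun-prefixes (b ∷ g))

-- rotate (i + 1) (b ∷ g) ends with take (i + 1) (b ∷ g).
lastRun-rotations : ∀ g → sumFin (length g) (λ i → lastRun (rotate (suc (toℕ i)) g)) ≡ verticalTotal g
lastRun-rotations []      = refl
lastRun-rotations (b ∷ g) = trans
  (cong Vec.sum (tabulate-cong {n = suc (length g)} (λ i → lastRun-++-∷ (drop (toℕ i) g) b (take (toℕ i) g))))
  (lastRun-prefixes (b ∷ g))

rotations-lastRun↔verticals : ∀ {n} g → length g ≡ n →
  Σ (Fin n) (λ i → Fin (lastRun (rotate (suc (toℕ i)) g))) ↔ Fin (verticalTotal g)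
rotations-lastRun↔verticals g refl =
  ↔-trans (Σ-Fin↔Fin-sumFin (length g) _) (Fin-cong (lastRun-rotations g))

staircase : ℕ → ℕ → List Block
staircase N zero    = (+ N , suc N) ∷ []
staircase N (suc m) = (+ N , N) ∷ staircase N m

staircase-ballotWord : ∀ {s} N m → T (s (+ N)) → BallotWord s (suc m)
staircase-ballotWord {s} N m U_N∈𝒮 =
  staircase N m , (length-staircase m , allowed m , netRise-staircase m) , ballot m
  where
  flat : rise (+ N , N) ≡ 0ℤ
  flat = ℤP.+-inverseʳ (+ N)

  length-staircase : ∀ m → length (staircase N m) ≡ suc m
  length-staircase zero    = refl
  length-staircase (suc m) = cong suc (length-staircase m)

  allowed : ∀ m → All (Allowed s) (staircase N m)
  allowed zero    = U_N∈𝒮 ∷ []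
  allowed (suc m) = U_N∈𝒮 ∷ allowed m

  netRise-staircase : ∀ m → netRise (staircase N m) ≡ -1ℤ
  netRise-staircase zero    = descent (+ N)
    where
    descent : ∀ x → (x ℤ.- (1ℤ ℤ.+ x)) ℤ.+ 0ℤ ≡ -1ℤ
    descent = solve-∀
  netRise-staircase (suc m) = cong₂ ℤ._+_ flat (netRise-staircase m)

  ballot : ∀ m → Ballot 0ℤ (staircase N m)
  ballot zero    = ℤP.≤-refl , tt
  ballot (suc m) = ℤP.≤-refl ,
    subst (λ y → Ballot y (staircase N m)) (sym (trans (ℤP.+-identityˡ _) flat)) (ballot m)

module Counting (s : ℤ → Bool) (m : ℕ) where

  F₁↔F₀⊎rotations : F s 1 (suc m) ↔ (F s 0 (suc m) ⊎ (Fin (suc m) × P s 1 (suc m)))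
  F₁↔F₀⊎rotations = ↔-trans (F₁↔F₀⊎Word s (suc m))
    (↔-refl ⊎-↔ ↔-trans (↔-sym (rotations↔words s m)) (↔-refl ×-↔ BallotWord↔P s m))

  F₀↔verticalChoices : F s 0 (suc m) ↔ Σ (P s 1 (suc m)) (λ path → Fin (countV (proj₁ path)))
  F₀↔verticalChoices =
    ↔-trans (F↔blockPaths s 0 (suc m))
    (↔-trans (blockPaths↔lastRunChoices s m)
    (↔-trans (↔-sym (Σ-↔ (rotations↔words s m) ↔-refl))
    (↔-trans (Σ-×-swap _)
    (↔-trans (Σ-↔ ↔-refl (λ {g} → rotations-lastRun↔verticals (proj₁ g) (proj₁ (proj₁ (proj₂ g)))))
             (Σ-↔ (BallotWord↔P s m) (λ {g} → Fin-cong (sym (countV-blockSteps (proj₁ g)))))))))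

  staircasePath : ∀ N → T (s (+ N)) → P s 1 (suc m)
  staircasePath N U_N∈𝒮 = Inverse.to (BallotWord↔P s m) (staircase-ballotWord N m U_N∈𝒮)

mainTheorem9 : (N : ℕ) (s : ℤ → Bool)
    → (∀ k → T (s k) → k ℤ.≤ + N)
    → T (s (+ N))
    → (n : ℕ) → n ≥ 1
    → (c₀ c₁ p : ℕ)
    → Fin c₀ ↔ F s 0 n
    → Fin c₁ ↔ F s 1 n
    → (e : Fin p ↔ P s 1 n)
    → (0 < p) × (c₀ < c₁)
      × (sumFin p (λ i → countV (proj₁ (Inverse.to e i))) * (c₁ ∸ c₀) ≡ n * c₀ * p)
mainTheorem9 N s _ U_N∈𝒮 (suc m) _ c₀ c₁ p I₀ I₁ e = 0<p , c₀<c₁ , expectation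
  where
  open Counting s m
  n = suc m

  c₁≡c₀+n*p : c₁ ≡ c₀ + n * p
  c₁≡c₀+n*p = Fin-card (↔-trans I₁ (↔-trans F₁↔F₀⊎rotations
    (↔-trans (↔-sym I₀ ⊎-↔ ↔-refl ×-↔ ↔-sym e)
    (↔-trans (↔-refl ⊎-↔ ↔-sym *↔×) (↔-sym +↔⊎)))))

  Σcount≡c₀ : sumFin p (λ i → countV (proj₁ (Inverse.to e i))) ≡ c₀
  Σcount≡c₀ = Fin-card (↔-trans (↔-sym (Σ-Fin↔Fin-sumFin p _))
    (↔-trans (Σ-↔ e ↔-refl) (↔-trans (↔-sym F₀↔verticalChoices) (↔-sym I₀))))

  0<p : 0 < p
  0<p = ℕ.>-nonZero⁻¹ p {{nonZeroIndex (Inverse.from e (staircasePath N U_N∈𝒮))}}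

  c₀<c₁ : c₀ < c₁
  c₀<c₁ = subst (c₀ <_) (sym c₁≡c₀+n*p)
    (ℕP.m<m+n c₀ (ℕP.≤-trans (s≤s z≤n) (ℕP.*-monoʳ-≤ n 0<p)))

  expectation : sumFin p (λ i → countV (proj₁ (Inverse.to e i))) * (c₁ ∸ c₀) ≡ n * c₀ * p
  expectation = begin
    sumFin p (λ i → countV (proj₁ (Inverse.to e i))) * (c₁ ∸ c₀)
      ≡⟨ cong₂ _*_ Σcount≡c₀ (trans (cong (_∸ c₀) c₁≡c₀+n*p) (ℕP.m+n∸m≡n c₀ (n * p))) ⟩
    c₀ * (n * p)
      ≡⟨ sym (ℕP.*-assoc c₀ n p) ⟩
    c₀ * n * p
      ≡⟨ cong (_* p) (ℕP.*-comm c₀ n) ⟩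
    n * c₀ * p ∎
    where open ≡-Reasoning
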